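{- Let $\varphi(\mathbf{x},\mathbf{y})$ be a prime P-encoding with $n\ge4$ input variables $\mathbf{x}=(x_1,\dots,x_n)$ such that $|Q_{\varphi,i}|=2$ for every $i$, but for some $i$ some clause of $Q_{\varphi,i}$ contains an input variable other than $x_i$. Then there is a P-encoding $\varphi'$ with $n-1$ input variables such that $|\varphi|\ge|\varphi'|+3$. If $\varphi$ is a 2-CNF formula, then so is $\varphi'$.
   Context: A CNF formula is a conjunction (set) of clauses (disjunctions of literals with no complementary pair); its size $|\varphi|$ is its number of clauses; a 2-CNF formula has all clauses of at most two literals. A clause is an implicate of $\varphi$ if every satisfying assignment of $\varphi$ satisfies it, a prime implicate if no proper subclause is an implicate; $\varphi$ is prime if all its clauses are prime implicates. Unit resolution: from a unit clause $l$ and a clause containing $\neg l$ derive the clause with $\neg l$ removed; $\varphi\wedge g\vdash_1 h$ means the literal $h$ is derivable from $\varphi$ and the unit clause $g$ by a sequence of unit resolutions. A CNF formula $\varphi(\mathbf{x},\mathbf{y})$ with input variables $x_1,\dots,x_n$ and auxiliary variables $\mathbf{y}$ is a P-encoding if (P1) $\varphi\wedge x_i$ is satisfiable for each $i$ and (P2) $\varphi\wedge x_i\vdash_1\neg x_j$ for all $i\ne j$. $Q_{\varphi,i}=\{C\in\varphi:\neg x_i\in C\}$. -}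

module Defs where

open import Data.Nat using (ℕ; _≤_; _+_; pred)
open import Data.Bool using (Bool; true; false)
import Data.Bool.Properties as BP
open import Data.Fin using (Fin)
import Data.Fin.Properties as FP
open import Data.Sum using (_⊎_; inj₁; inj₂)
import Data.Sum.Properties as SP
open import Data.Product using (Σ; ∃; ∃-syntax; _×_; _,_)
import Data.Product.Properties as PP
open import Data.List using (List; []; _∷_; length; filter)
open import Data.List.Relation.Unary.All using (All)
open import Data.List.Relation.Unary.Any using (Any)
open import Data.List.Relation.Unary.AllPairs using (AllPairs)
open import Data.List.Relation.Unary.Unique.Propositional using (Unique)
open import Relation.Nullary using (¬_; Dec; yes; no)
open import Relation.Binary.PropositionalEquality using (_≡_; _≢_)
open import Relation.Binary.Definitions using (DecidableEquality)
import Data.List.Membership.Propositional as MemP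
import Data.List.Membership.DecPropositional as MemD

-- Variables of a formula with n input variables and m auxiliary variables:
-- inj₁ i is the input variable x_i, inj₂ k is an auxiliary variable y_k.
Var : ℕ → ℕ → Set
Var n m = Fin n ⊎ Fin m

_≟V_ : ∀ {n m} → DecidableEquality (Var n m)
_≟V_ = SP.≡-dec FP._≟_ FP._≟_

-- A literal: (true , v) is the positive literal v, (false , v) is ¬ v.
Lit : ℕ → ℕ → Set
Lit n m = Bool × Var n m

_≟L_ : ∀ {n m} → DecidableEquality (Lit n m)
_≟L_ = PP.≡-dec BP._≟_ _≟V_

pos neg : ∀ {n m} → Var n m → Lit n m
pos v = (true , v)
neg v = (false , v)

compl : ∀ {n m} → Lit n m → Lit n m
compl (b , v) = (Data.Bool.not b , v)

x : ∀ {n m} → Fin n → Var n m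
x i = inj₁ i

-- Clauses and formulas are represented by lists; well-formedness below makes
-- them sets (no repeated literal / no repeated clause up to set equality).
Clause : ℕ → ℕ → Set
Clause n m = List (Lit n m)

CNF : ℕ → ℕ → Set
CNF n m = List (Clause n m)

module _ {n m : ℕ} where
  open MemP {A = Lit n m} using (_∈_)
  open MemD {A = Lit n m} _≟L_ using (_∈?_)

  _⊆C_ : Clause n m → Clause n m → Set
  C ⊆C D = ∀ {l} → l ∈ C → l ∈ D

  _≈C_ : Clause n m → Clause n m → Set
  C ≈C D = (C ⊆C D) × (D ⊆C C)

  WFClause : Clause n m → Set
  WFClause C = Unique C × (¬ (∃[ v ] ((pos v ∈ C) × (neg v ∈ C))))

  WFCNF : CNF n m → Set
  WFCNF φ = All WFClause φ × AllPairs (λ C D → ¬ (C ≈C D)) φ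

  size : CNF n m → ℕ
  size φ = length φ

  Is2CNF : CNF n m → Set
  Is2CNF φ = All (λ C → length C ≤ 2) φ

  Assignment : Set
  Assignment = Var n m → Bool

  litVal : Assignment → Lit n m → Bool
  litVal α (true , v) = α v
  litVal α (false , v) = Data.Bool.not (α v)

  SatClause : Assignment → Clause n m → Set
  SatClause α C = Any (λ l → litVal α l ≡ true) C

  Sat : Assignment → CNF n m → Set
  Sat α φ = All (SatClause α) φ

  Implicate : CNF n m → Clause n m → Set
  Implicate φ C = ∀ (α : Assignment) → Sat α φ → SatClause α C

  PrimeImplicate : CNF n m → Clause n m → Set
  PrimeImplicate φ C =
    Implicate φ C × (∀ D → D ⊆C C → ¬ (C ⊆C D) → ¬ Implicate φ D)

  Prime : CNF n m → Set
  Prime φ = All (PrimeImplicate φ) φ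

  remove : Lit n m → Clause n m → Clause n m
  remove l C = filter (λ k → Relation.Nullary.¬? (k ≟L l)) C

  data URDerives (φ : CNF n m) (g : Lit n m) : Clause n m → Set where
    axiom : ∀ {C} → MemP._∈_ C φ → URDerives φ g C
    given : URDerives φ g (g ∷ [])
    resolve : ∀ {l C} → URDerives φ g (l ∷ []) → URDerives φ g C →
              compl l ∈ C → URDerives φ g (remove (compl l) C)

  _∧_⊢₁_ : CNF n m → Lit n m → Lit n m → Set
  φ ∧ g ⊢₁ h = URDerives φ g (h ∷ [])

  PEncoding : CNF n m → Set
  PEncoding φ =
    (∀ (i : Fin n) → ∃[ α ] ((α (x i) ≡ true) × Sat α φ)) ×
    (∀ (i j : Fin n) → i ≢ j → φ ∧ pos (x i) ⊢₁ neg (x j))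

  Q : CNF n m → Fin n → CNF n m
  Q φ i = filter (λ C → neg (x i) ∈? C) φ

module Submission where

-- Primality and the P-encoding conditions pin down Q_{φ,i} = {C, A} with C = ¬x_i ∨ ¬x_j
-- and A = ¬x_i ∨ r, where r is a literal on an auxiliary variable y. The shape of A comes from
-- unit propagation: from x_i one must derive ¬x_l for some l ∉ {i, j} (here n ≥ 4 is used), and
-- this is impossible unless A fires, which makes ¬x_i ∨ r an implicate. The reduced encoding
-- deletes the clauses containing ¬x_i or ¬x_j (at least three, by inclusion–exclusion) and the
-- literal x_j, and merges x_i with r into one input variable; models and unit propagation of φ
-- transfer to it. A final normalisation (removing repeated literals, tautologies and repeated
-- clauses) makes it a well-formed formula without breaking any of this.

open import Defs
open import Level using (0ℓ)
open import Function using (_∘_)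
open import Data.Nat using (ℕ; _≤_; _<_; _+_; pred; suc; z≤n; s≤s)
open import Data.Nat.Properties
  using (≤-trans; n≤1+n; +-suc; +-assoc; +-cancelʳ-≤; +-monoʳ-≤; +-monoˡ-≤; module ≤-Reasoning)
open import Data.Fin using (Fin; punchIn; punchOut)
import Data.Fin.Properties as FinP
open import Data.Fin.Properties
  using (¬∀⟶∃¬; pigeonhole; <⇒≢; punchOut-cong; punchOut-punchIn; punchIn-punchOut; punchInᵢ≢i;
         punchIn-injective)
open import Data.Bool using (Bool; true; false; not; _∨_)
open import Data.Bool.Properties using (not-involutive)
open import Data.Product using (∃; ∃-syntax; _×_; _,_; proj₁; proj₂)
open import Data.Sum using (_⊎_; inj₁; inj₂)
open import Data.Empty using (⊥-elim)
open import Data.List using (List; []; _∷_; length; filter; map; deduplicate)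
import Data.List as List
open import Data.List.Properties using (length-map; length-filter; length-deduplicate)
open import Data.List.Membership.Propositional using (_∈_; _∉_; find; lose)
open import Data.List.Membership.Propositional.Properties
  using (∈-filter⁺; ∈-filter⁻; ∈-map⁺; ∈-map⁻; ∈-deduplicate⁺; ∈-deduplicate⁻)
import Data.List.Membership.Setoid.Properties as SetoidMembership
import Data.List.Membership.DecPropositional as DecMembership
open import Data.List.Relation.Unary.Any using (Any; here; there; any?)
import Data.List.Relation.Unary.Any as Any
open import Data.List.Relation.Unary.Any.Properties using (lookup-index)
open import Data.List.Relation.Unary.All using ([]; _∷_; lookup; tabulate; all?)
open import Data.List.Relation.Unary.AllPairs using (AllPairs; []; _∷_)
import Data.List.Relation.Unary.AllPairs.Properties as AllPairs
open import Data.List.Relation.Unary.Unique.Propositional using (Unique)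
import Data.List.Relation.Unary.Unique.Propositional.Properties as Unique
open import Data.List.Relation.Unary.Unique.DecSetoid.Properties using (deduplicate-!)
open import Data.List.Relation.Unary.Unique.DecPropositional.Properties
  using () renaming (deduplicate-! to deduplicate-!≡)
open import Relation.Nullary using (¬_; Dec; yes; no; ¬?; does)
open import Relation.Nullary.Decidable using (map′; _×-dec_; dec-true; dec-false)
open import Relation.Unary using (Decidable)
open import Relation.Binary.Bundles using (DecSetoid)
open import Relation.Binary.Definitions using (DecidableEquality)
open import Relation.Binary.PropositionalEquality

false≢true : false ≢ true
false≢true ()

partner : ∀ {A : Set} {R : A → A → Set} → (∀ {a b} → R a b → R b a) →
          (xs : List A) → length xs ≡ 2 → AllPairs (λ a b → ¬ R a b) xs →
          ∀ {c} → c ∈ xs → ∃[ d ] (d ∈ xs × ¬ R c d × (∀ {e} → e ∈ xs → e ≡ c ⊎ e ≡ d))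
partner R-sym (a ∷ b ∷ []) refl ((¬ab ∷ []) ∷ _) (here refl) =
  b , there (here refl) , ¬ab , λ { (here refl) → inj₁ refl ; (there (here refl)) → inj₂ refl }
partner R-sym (a ∷ b ∷ []) refl ((¬ab ∷ []) ∷ _) (there (here refl)) =
  a , here refl , (λ ba → ¬ab (R-sym ba)) , λ { (here refl) → inj₂ refl ; (there (here refl)) → inj₁ refl }

all-or-witness : ∀ {A : Set} {P : A → Set} {F : Set} → DecidableEquality A → ∀ {h} (xs : List A) →
                 (∀ {a} → a ∈ xs → a ≢ h → P a ⊎ F) → (∀ {a} → a ∈ xs → a ≢ h → P a) ⊎ F
all-or-witness _≟_ [] each = inj₁ λ ()
all-or-witness _≟_ {h} (a ∷ xs) each with all-or-witness _≟_ xs (λ a∈ → each (there a∈))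
... | inj₂ f = inj₂ f
... | inj₁ rest with a ≟ h
...   | yes refl = inj₁ λ { (here refl) a≢h → ⊥-elim (a≢h refl) ; (there a∈) → rest a∈ }
...   | no a≢h with each (here refl) a≢h
...     | inj₂ f = inj₂ f
...     | inj₁ pa = inj₁ λ { (here refl) _ → pa ; (there a∈) → rest a∈ }

module _ {A : Set} {P R : A → Set} (P? : Decidable P) (R? : Decidable R) where

  neither? : Decidable (λ a → ¬ P a × ¬ R a)
  neither? a = ¬? (P? a) ×-dec ¬? (R? a)

  both? : Decidable (λ a → P a × R a)
  both? a = P? a ×-dec R? a

  filter-count : (xs : List A) →
    length (filter neither? xs) + length (filter P? xs) + length (filter R? xs)
      ≡ length xs + length (filter both? xs)
  filter-count [] = refl
  filter-count (a ∷ xs) with P? a | R? a | filter-count xs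
  ... | yes _ | yes _ | ih
    rewrite +-suc (length (filter neither? xs)) (length (filter P? xs))
          | +-suc (length (filter neither? xs) + length (filter P? xs)) (length (filter R? xs))
          | +-suc (length xs) (length (filter both? xs)) = cong (suc ∘ suc) ih
  ... | yes _ | no _ | ih
    rewrite +-suc (length (filter neither? xs)) (length (filter P? xs)) = cong suc ih
  ... | no _ | yes _ | ih
    rewrite +-suc (length (filter neither? xs) + length (filter P? xs)) (length (filter R? xs)) = cong suc ih
  ... | no _ | no _ | ih = cong suc ih

at-most-one-copy : ∀ {A : Set} {R : A → A → Set} {c : A} → (∀ {a} → R a a) → (xs : List A) →
                   AllPairs (λ a b → ¬ R a b) xs → (∀ {a} → a ∈ xs → a ≡ c) → length xs ≤ 1
at-most-one-copy R-refl [] _ _ = z≤n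
at-most-one-copy R-refl (a ∷ []) _ _ = s≤s z≤n
at-most-one-copy R-refl (a ∷ b ∷ xs) ((¬ab ∷ _) ∷ _) all-c with all-c (here refl) | all-c (there (here refl))
... | refl | refl = ⊥-elim (¬ab R-refl)

three-dropped : ∀ k L d → k + 2 + 2 ≡ L + d → d ≤ 1 → k + 3 ≤ L
three-dropped k L d eq d≤1 = +-cancelʳ-≤ 1 (k + 3) L (begin
  k + 3 + 1 ≡⟨ +-assoc k 3 1 ⟩
  k + 4     ≡⟨ +-assoc k 2 2 ⟨
  k + 2 + 2 ≡⟨ eq ⟩
  L + d     ≤⟨ +-monoʳ-≤ L d≤1 ⟩
  L + 1     ∎)
  where open ≤-Reasoning

fresh : ∀ {N} (xs : List (Fin N)) → length xs < N → ∃[ l ] (l ∉ xs)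
fresh {N} xs |xs|<N = ¬∀⟶∃¬ N (_∈ xs) (λ l → l ∈Fin? xs) not-all
  where
  open DecMembership FinP._≟_ using () renaming (_∈?_ to _∈Fin?_)
  not-all : ¬ (∀ l → l ∈ xs)
  not-all all with pigeonhole |xs|<N (λ l → Any.index (all l))
  ... | a , b , a<b , same-index = <⇒≢ a<b (begin
    a                                ≡⟨ lookup-index (all a) ⟩
    List.lookup xs (Any.index (all a)) ≡⟨ cong (List.lookup xs) same-index ⟩
    List.lookup xs (Any.index (all b)) ≡⟨ lookup-index (all b) ⟨
    b                                ∎)
    where open ≡-Reasoning

third : ∀ {N} → 3 ≤ N → (a b : Fin N) → ∃[ l ] (l ≢ a × l ≢ b)
third 3≤N a b with fresh (a ∷ b ∷ []) 3≤N
... | l , l∉ = l , (λ { refl → l∉ (here refl) }) , (λ { refl → l∉ (there (here refl)) })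

fourth : ∀ {N} → 4 ≤ N → (a b c : Fin N) → ∃[ l ] (l ≢ a × l ≢ b × l ≢ c)
fourth 4≤N a b c with fresh (a ∷ b ∷ c ∷ []) 4≤N
... | l , l∉ = l , (λ { refl → l∉ (here refl) }) , (λ { refl → l∉ (there (here refl)) }) ,
               (λ { refl → l∉ (there (there (here refl))) })

litVal-cong : ∀ {n m n′ m′} {α : Assignment {n} {m}} {β : Assignment {n′} {m′}} t v w →
              β w ≡ α v → litVal β (t , w) ≡ litVal α (t , v)
litVal-cong true v w βw≡αv = βw≡αv
litVal-cong false v w βw≡αv = cong not βw≡αv

module Literals {n m : ℕ} where

  compl-involutive : (l : Lit n m) → compl (compl l) ≡ l
  compl-involutive (true , v) = refl
  compl-involutive (false , v) = refl

  compl-flip : ∀ {l k : Lit n m} → compl l ≡ k → l ≡ compl k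
  compl-flip {l} refl = sym (compl-involutive l)

  compl-≢ : (l : Lit n m) → compl l ≢ l
  compl-≢ (true , v) ()
  compl-≢ (false , v) ()

  litVal-compl : (α : Assignment) (l : Lit n m) → litVal α (compl l) ≡ not (litVal α l)
  litVal-compl α (true , v) = refl
  litVal-compl α (false , v) = sym (not-involutive _)

  litVal-compl-true : (α : Assignment) (l : Lit n m) →
                      litVal α l ≡ true → litVal α (compl l) ≢ true
  litVal-compl-true α l l-true cl-true
    rewrite litVal-compl α l | l-true = false≢true cl-true

  open DecMembership {A = Lit n m} _≟L_ using (_∈?_)

  _[_↦true] : Assignment → Var n m → Assignment
  (α [ v ↦true]) w = does (w ≟V v) ∨ α w

  ↦true-here : ∀ α v → (α [ v ↦true]) v ≡ true
  ↦true-here α v = cong (_∨ α v) (dec-true (v ≟V v) refl)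

  ↦true-elsewhere : ∀ α {v w} → w ≢ v → (α [ v ↦true]) w ≡ α w
  ↦true-elsewhere α {v} {w} w≢v = cong (_∨ α w) (dec-false (w ≟V v) w≢v)

  x-injective : ∀ {a c : Fin n} → x {n} {m} a ≡ x c → a ≡ c
  x-injective refl = refl

  Q⁻ : ∀ {φ : CNF n m} {i D} → D ∈ Q φ i → D ∈ φ × neg (x i) ∈ D
  Q⁻ {φ} {i} D∈Q = ∈-filter⁻ (λ D → neg (x i) ∈? D) {xs = φ} D∈Q

  Q⁺ : ∀ {φ : CNF n m} {i D} → D ∈ φ → neg (x i) ∈ D → D ∈ Q φ i
  Q⁺ {φ} {i} D∈φ ¬xi∈D = ∈-filter⁺ (λ D → neg (x i) ∈? D) D∈φ ¬xi∈D

-- Unit propagation: the derivations of Defs (URDerives) are equivalent to the literal-level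
-- relation Forces, which is easier to reason about by induction.
module UnitPropagation {n m : ℕ} where
  open Literals {n} {m}
  open DecMembership {A = Lit n m} _≟L_ using (_∈?_)

  data Forces (ψ : CNF n m) (g : Lit n m) : Lit n m → Set where
    start : Forces ψ g g
    fire  : ∀ {D h} → D ∈ ψ → h ∈ D →
            (∀ {l} → l ∈ D → l ≢ h → Forces ψ g (compl l)) → Forces ψ g h

  forces-sound : ∀ {ψ g h} (α : Assignment) → Sat α ψ → litVal α g ≡ true →
                 Forces ψ g h → litVal α h ≡ true
  forces-sound α α⊨ψ g-true start = g-true
  forces-sound {h = h} α α⊨ψ g-true (fire D∈ψ h∈D refuted)
    with find (lookup α⊨ψ D∈ψ)
  ... | d , d∈D , d-true with d ≟L h
  ...   | yes refl = d-true
  ...   | no d≢h = ⊥-elim (litVal-compl-true α d d-true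
                             (forces-sound α α⊨ψ g-true (refuted d∈D d≢h)))

  -- Invariant of unit-resolution derivations: a derived clause is a subclause of a clause
  -- of ψ or of the unit g, and every literal it has lost has a forced complement.
  Resolvent : CNF n m → Lit n m → Clause n m → Set
  Resolvent ψ g D = ∃[ E ] ((E ∈ ψ ⊎ E ≡ g ∷ []) × D ⊆C E ×
                            (∀ {l} → l ∈ E → l ∉ D → Forces ψ g (compl l)))

  -- A derived unit clause h is forced: its origin clause fires towards h.
  unit-resolvent : ∀ {ψ g h} → Resolvent ψ g (h ∷ []) → Forces ψ g h
  unit-resolvent (E , inj₁ E∈ψ , h⊆E , lost) =
    fire E∈ψ (h⊆E (here refl)) (λ l∈E l≢h → lost l∈E λ { (here l≡h) → l≢h l≡h })
  unit-resolvent (E , inj₂ refl , h⊆E , lost) with h⊆E (here refl)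
  ... | here refl = start

  derivation-resolvent : ∀ {ψ g D} → URDerives ψ g D → Resolvent ψ g D
  derivation-resolvent (axiom C∈ψ) = _ , inj₁ C∈ψ , (λ k∈ → k∈) , λ l∈ l∉ → ⊥-elim (l∉ l∈)
  derivation-resolvent given = _ , inj₂ refl , (λ k∈ → k∈) , λ l∈ l∉ → ⊥-elim (l∉ l∈)
  derivation-resolvent {ψ} {g} (resolve {l} {C} unit d cl∈C)
    with derivation-resolvent d
  ... | E , origin , C⊆E , lost = E , origin , remove⊆E , lost′
    where
    keep? = λ k → ¬? (k ≟L compl l)
    remove⊆E : remove (compl l) C ⊆C E
    remove⊆E k∈ = C⊆E (proj₁ (∈-filter⁻ keep? k∈))
    lost′ : ∀ {k} → k ∈ E → k ∉ remove (compl l) C → Forces ψ g (compl k)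
    lost′ {k} k∈E k∉ with k ≟L compl l
    ... | yes refl rewrite compl-involutive l = unit-resolvent (derivation-resolvent unit)
    ... | no k≢ = lost k∈E (λ k∈C → k∉ (∈-filter⁺ keep? k∈C k≢))

  ⊢₁⇒forces : ∀ {ψ g h} → ψ ∧ g ⊢₁ h → Forces ψ g h
  ⊢₁⇒forces d = unit-resolvent (derivation-resolvent d)

  resolve-all : ∀ {ψ g h} (Ls S : Clause n m) → URDerives ψ g S → Unique S → h ∈ S →
    (∀ {l} → l ∈ Ls → l ≢ h → URDerives ψ g (compl l ∷ [])) →
    ∃[ S′ ] (URDerives ψ g S′ × Unique S′ × S′ ⊆C S × h ∈ S′ ×
             (∀ {l} → l ∈ Ls → l ≢ h → l ∉ S′))
  resolve-all [] S d S! h∈S units = S , d , S! , (λ k∈ → k∈) , h∈S , λ ()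
  resolve-all {ψ} {g} {h} (l ∷ Ls) S d S! h∈S units
    with resolve-all Ls S d S! h∈S (λ l∈ → units (there l∈))
  ... | S′ , d′ , S′! , S′⊆S , h∈S′ , gone with l ≟L h | l ∈? S′
  ...   | yes refl | _ =
          S′ , d′ , S′! , S′⊆S , h∈S′ , λ { (here refl) l≢h → ⊥-elim (l≢h refl) ; (there k∈) → gone k∈ }
  ...   | no l≢h | no l∉S′ =
          S′ , d′ , S′! , S′⊆S , h∈S′ , λ { (here refl) _ → l∉S′ ; (there k∈) → gone k∈ }
  ...   | no l≢h | yes l∈S′ =
          remove l S′ , d″ , Unique.filter⁺ keep? S′! , (λ k∈ → S′⊆S (proj₁ (∈-filter⁻ keep? k∈))) ,
          ∈-filter⁺ keep? h∈S′ (≢-sym l≢h) , gone′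
    where
    keep? = λ k → ¬? (k ≟L l)
    d″ : URDerives ψ g (remove l S′)
    d″ = subst (λ k → URDerives ψ g (remove k S′)) (compl-involutive l)
           (resolve (units (here refl) l≢h) d′ (subst (_∈ S′) (sym (compl-involutive l)) l∈S′))
    gone′ : ∀ {k} → k ∈ l ∷ Ls → k ≢ h → k ∉ remove l S′
    gone′ (here refl) _ k∈ = proj₂ (∈-filter⁻ keep? {xs = S′} k∈) refl
    gone′ (there k∈Ls) k≢h k∈ = gone k∈Ls k≢h (proj₁ (∈-filter⁻ keep? {xs = S′} k∈))

  unique-singleton : ∀ {h : Lit n m} (S : Clause n m) → Unique S → h ∈ S →
                     (∀ {k} → k ∈ S → k ≡ h) → S ≡ h ∷ []
  unique-singleton (s ∷ []) _ _ only-h = cong (_∷ []) (only-h (here refl))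
  unique-singleton (s ∷ t ∷ S) ((s∉ ∷ _) ∷ _) _ only-h =
    ⊥-elim (s∉ (trans (only-h (here refl)) (sym (only-h (there (here refl))))))

  forces⇒⊢₁ : ∀ {ψ g h} → (∀ {D} → D ∈ ψ → Unique D) → Forces ψ g h → ψ ∧ g ⊢₁ h
  forces⇒⊢₁ ψ! start = given
  forces⇒⊢₁ {ψ} {g} {h} ψ! (fire {D} D∈ψ h∈D refuted)
    with resolve-all D D (axiom D∈ψ) (ψ! D∈ψ) h∈D (λ l∈ l≢h → forces⇒⊢₁ ψ! (refuted l∈ l≢h))
  ... | S , d , S! , S⊆D , h∈S , gone = subst (URDerives ψ g) (unique-singleton S S! h∈S only-h) d
    where
    only-h : ∀ {k} → k ∈ S → k ≡ h
    only-h {k} k∈S with k ≟L h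
    ... | yes k≡h = k≡h
    ... | no k≢h = ⊥-elim (gone (S⊆D k∈S) k≢h k∈S)

module Normalisation {n m : ℕ} where
  open Literals {n} {m}
  open UnitPropagation {n} {m}
  open DecMembership {A = Lit n m} _≟L_ using (_∈?_)

  _⊆C?_ : (C D : Clause n m) → Dec (C ⊆C D)
  C ⊆C? D = map′ (λ all-in l∈C → lookup all-in l∈C) tabulate (all? (_∈? D) C)

  _≈C?_ : (C D : Clause n m) → Dec (C ≈C D)
  C ≈C? D = (C ⊆C? D) ×-dec (D ⊆C? C)

  clauseSetoid : DecSetoid 0ℓ 0ℓ
  clauseSetoid = record
    { Carrier = Clause n m
    ; _≈_ = _≈C_
    ; isDecEquivalence = record
      { isEquivalence = record
        { refl = (λ l∈ → l∈) , (λ l∈ → l∈)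
        ; sym = λ (C⊆D , D⊆C) → D⊆C , C⊆D
        ; trans = λ (C⊆D , D⊆C) (D⊆E , E⊆D) → (λ l∈ → D⊆E (C⊆D l∈)) , (λ l∈ → D⊆C (E⊆D l∈))
        }
      ; _≟_ = _≈C?_
      }
    }
  open DecSetoid clauseSetoid using ()
    renaming (setoid to clauseSetoid₀; refl to ≈C-refl; sym to ≈C-sym; trans to ≈C-trans)

  Tautology : Clause n m → Set
  Tautology D = Any (λ l → compl l ∈ D) D

  tautology? : (D : Clause n m) → Dec (Tautology D)
  tautology? D = any? (λ l → compl l ∈? D) D

  dedupLits : Clause n m → Clause n m
  dedupLits = deduplicate _≟L_

  nonTautology? : (D : Clause n m) → Dec (¬ Tautology D)
  nonTautology? D = ¬? (tautology? D)

  normalise : CNF n m → CNF n m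
  normalise ψ = deduplicate _≈C?_ (filter nonTautology? (map dedupLits ψ))

  normalise-origin : ∀ {ψ E} → E ∈ normalise ψ → ∃[ D ] (D ∈ ψ × E ≡ dedupLits D × ¬ Tautology E)
  normalise-origin {ψ} E∈ with ∈-filter⁻ nonTautology? {xs = map dedupLits ψ}
                                  (∈-deduplicate⁻ _≈C?_ (filter nonTautology? (map dedupLits ψ)) E∈)
  ... | E∈map , non-taut with ∈-map⁻ dedupLits E∈map
  ...   | D , D∈ψ , refl = D , D∈ψ , refl , non-taut

  normalise-covers : ∀ {ψ D} → D ∈ ψ → ¬ Tautology D → ∃[ E ] (E ∈ normalise ψ × E ≈C D)
  normalise-covers {ψ} {D} D∈ψ non-taut
    with find (SetoidMembership.∈-deduplicate⁺ clauseSetoid₀ _≈C?_ (λ F≈E D≈E → ≈C-trans D≈E (≈C-sym F≈E))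
                (Any.map (λ { refl → ≈C-refl }) kept))
    where
    non-taut′ : ¬ Tautology (dedupLits D)
    non-taut′ taut with find taut
    ... | l , l∈ , cl∈ = non-taut (lose (∈-deduplicate⁻ _≟L_ D l∈) (∈-deduplicate⁻ _≟L_ D cl∈))
    kept : dedupLits D ∈ filter nonTautology? (map dedupLits ψ)
    kept = ∈-filter⁺ nonTautology? (∈-map⁺ dedupLits D∈ψ) non-taut′
  ... | E , E∈ , D≈E = E , E∈ , ≈C-trans (≈C-sym D≈E) (∈-deduplicate⁻ _≟L_ D , ∈-deduplicate⁺ _≟L_)

  normalise-wf : ∀ ψ → WFCNF (normalise ψ)
  normalise-wf ψ = tabulate wf-clause , deduplicate-! clauseSetoid _
    where
    wf-clause : ∀ {E} → E ∈ normalise ψ → WFClause E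
    wf-clause E∈ with normalise-origin {ψ} E∈
    ... | D , _ , refl , non-taut =
      deduplicate-!≡ _≟L_ D , λ (v , pos∈ , neg∈) → non-taut (lose pos∈ neg∈)

  normalise-unique : ∀ ψ {E} → E ∈ normalise ψ → Unique E
  normalise-unique ψ E∈ = proj₁ (lookup (proj₁ (normalise-wf ψ)) E∈)

  normalise-sat : ∀ {ψ} (α : Assignment) → Sat α ψ → Sat α (normalise ψ)
  normalise-sat {ψ} α α⊨ψ = tabulate sat
    where
    sat : ∀ {E} → E ∈ normalise ψ → SatClause α E
    sat E∈ with normalise-origin {ψ} E∈
    ... | D , D∈ψ , refl , _ with find (lookup α⊨ψ D∈ψ)
    ...   | l , l∈D , l-true = lose (∈-deduplicate⁺ _≟L_ l∈D) l-true

  -- Normalisation preserves unit propagation from a literal g that is consistent with ψ: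
  -- a tautology can only fire when the complement of a true literal was forced.
  normalise-forces : ∀ {ψ g h} (α : Assignment) → Sat α ψ → litVal α g ≡ true →
                     Forces ψ g h → Forces (normalise ψ) g h
  normalise-forces α α⊨ψ g-true start = start
  normalise-forces {ψ} {g} {h} α α⊨ψ g-true (fire {D} D∈ψ h∈D refuted) with tautology? D
  ... | no non-taut with normalise-covers {ψ} D∈ψ non-taut
  ...   | E , E∈ , (E⊆D , D⊆E) =
          fire E∈ (D⊆E h∈D) (λ l∈E l≢h → normalise-forces α α⊨ψ g-true (refuted (E⊆D l∈E) l≢h))
  normalise-forces {ψ} {g} {h} α α⊨ψ g-true (fire {D} D∈ψ h∈D refuted) | yes taut
    with find taut
  ... | p , p∈D , cp∈D with p ≟L h | compl p ≟L h
  ...   | yes refl | _ = subst (Forces (normalise ψ) g) (compl-involutive p)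
                           (normalise-forces α α⊨ψ g-true (refuted cp∈D (compl-≢ p)))
  ...   | no _ | yes refl = normalise-forces α α⊨ψ g-true (refuted p∈D (λ p≡h → compl-≢ p (sym p≡h)))
  ...   | no p≢h | no cp≢h =
          ⊥-elim (litVal-compl-true α (compl p) (force (refuted p∈D p≢h)) (force (refuted cp∈D cp≢h)))
    where
    force : ∀ {k} → Forces ψ g k → litVal α k ≡ true
    force = forces-sound α α⊨ψ g-true

  normalise-size : ∀ ψ → size (normalise ψ) ≤ size ψ
  normalise-size ψ = begin
    length (deduplicate _≈C?_ ψ′) ≤⟨ length-deduplicate _≈C?_ ψ′ ⟩
    length ψ′                     ≤⟨ length-filter nonTautology? (map dedupLits ψ) ⟩
    length (map dedupLits ψ)      ≡⟨ length-map dedupLits ψ ⟩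
    length ψ                      ∎
    where
    open ≤-Reasoning
    ψ′ = filter nonTautology? (map dedupLits ψ)

  normalise-2cnf : ∀ ψ → Is2CNF ψ → Is2CNF (normalise ψ)
  normalise-2cnf ψ ψ-2cnf = tabulate short
    where
    short : ∀ {E} → E ∈ normalise ψ → length E ≤ 2
    short E∈ with normalise-origin {ψ} E∈
    ... | D , D∈ψ , refl , _ = ≤-trans (length-deduplicate _≟L_ D) (lookup ψ-2cnf D∈ψ)

module PEncodingFacts {n m : ℕ} (φ : CNF n m) (pe : PEncoding φ) where
  open UnitPropagation {n} {m}

  model : Fin n → Assignment
  model a = proj₁ (proj₁ pe a)

  model-true : ∀ a → model a (x a) ≡ true
  model-true a = proj₁ (proj₂ (proj₁ pe a))

  model-sat : ∀ a → Sat (model a) φ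
  model-sat a = proj₂ (proj₂ (proj₁ pe a))

  forces-¬x : ∀ a c → a ≢ c → Forces φ (pos (x a)) (neg (x c))
  forces-¬x a c a≢c = ⊢₁⇒forces (proj₂ pe a c a≢c)

  at-most-one : ∀ (β : Assignment) → Sat β φ → ∀ a c → a ≢ c → β (x a) ≡ true → β (x c) ≡ false
  at-most-one β β⊨φ a c a≢c xa-true with β (x c) | forces-sound β β⊨φ xa-true (forces-¬x a c a≢c)
  ... | false | _ = refl
  ... | true | ()

  model-false : ∀ a c → a ≢ c → model a (x c) ≡ false
  model-false a c a≢c = at-most-one (model a) (model-sat a) a c a≢c (model-true a)

  pair-implicate : ∀ a c → a ≢ c → Implicate φ (neg (x a) ∷ neg (x c) ∷ [])
  pair-implicate a c a≢c β β⊨φ with β (x a) in xa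
  ... | false = here (cong not xa)
  ... | true = there (here (cong not (at-most-one β β⊨φ a c a≢c xa)))

module PrimeFacts {n m : ℕ} (φ : CNF n m) (pr : Prime φ) where
  open DecMembership {A = Lit n m} _≟L_ using (_∈?_)

  prime-⊆ : ∀ {D D′} → D ∈ φ → D′ ⊆C D → Implicate φ D′ → D ⊆C D′
  prime-⊆ {D} {D′} D∈φ D′⊆D D′-implicate {l} l∈D with l ∈? D′
  ... | yes l∈D′ = l∈D′
  ... | no l∉D′ = ⊥-elim (proj₂ (lookup pr D∈φ) D′ D′⊆D (λ D⊆D′ → l∉D′ (D⊆D′ l∈D)) D′-implicate)

  prime-pair : ∀ {D a b} → D ∈ φ → a ∈ D → b ∈ D → Implicate φ (a ∷ b ∷ []) →
               ∀ {l} → l ∈ D → l ≡ a ⊎ l ≡ b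
  prime-pair D∈φ a∈D b∈D ab-implicate l∈D
    with prime-⊆ D∈φ (λ { (here refl) → a∈D ; (there (here refl)) → b∈D }) ab-implicate l∈D
  ... | here l≡a = inj₁ l≡a
  ... | there (here l≡b) = inj₂ l≡b

  prime-essential : ∀ {D l} → D ∈ φ → l ∈ D → ¬ Implicate φ (remove l D)
  prime-essential {D} {l} D∈φ l∈D =
    proj₂ (lookup pr D∈φ) (remove l D) (λ k∈ → proj₁ (∈-filter⁻ keep? {xs = D} k∈))
          (λ D⊆ → proj₂ (∈-filter⁻ keep? {xs = D} (D⊆ l∈D)) refl)
    where keep? = λ k → ¬? (k ≟L l)

module QStructure {n m : ℕ} (φ : CNF n m) (wf : WFCNF φ) (pr : Prime φ) (pe : PEncoding φ)
                  (4≤n : 4 ≤ n) (i j : Fin n) (j≢i : j ≢ i) (|Qi|≡2 : size (Q φ i) ≡ 2)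
                  (C : Clause n m) (C∈Qi : C ∈ Q φ i) (b : Bool) (bxj∈C : (b , x j) ∈ C) where
  open Literals {n} {m}
  open UnitPropagation {n} {m}
  open PEncodingFacts φ pe
  open PrimeFacts φ pr
  open DecMembership {A = Lit n m} _≟L_ using (_∈?_)

  i≢j : i ≢ j
  i≢j = ≢-sym j≢i

  C∈φ : C ∈ φ
  C∈φ = proj₁ (Q⁻ {φ = φ} C∈Qi)

  ¬xi∈C : neg (x i) ∈ C
  ¬xi∈C = proj₂ (Q⁻ {φ = φ} C∈Qi)

  -- x_j occurs negatively in C: a positive x_j could be dropped from C, because x_j already
  -- makes ¬x_i true.
  xj-negative : ∀ b′ → (b′ , x j) ∈ C → b′ ≡ false
  xj-negative false _ = refl
  xj-negative true xj∈C = ⊥-elim (prime-essential C∈φ xj∈C drop-xj)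
    where
    keep? = λ l → ¬? (l ≟L pos (x j))
    drop-xj : Implicate φ (remove (pos (x j)) C)
    drop-xj β β⊨φ with find (lookup β⊨φ C∈φ)
    ... | l , l∈C , l-true with l ≟L pos (x j)
    ...   | no l≢xj = lose (∈-filter⁺ keep? l∈C l≢xj) l-true
    ...   | yes refl = lose (∈-filter⁺ keep? ¬xi∈C (λ ())) (cong not (at-most-one β β⊨φ j i j≢i l-true))

  ¬xj∈C : neg (x j) ∈ C
  ¬xj∈C = subst (λ t → (t , x j) ∈ C) (xj-negative b bxj∈C) bxj∈C

  C-shape : ∀ {l} → l ∈ C → l ≡ neg (x i) ⊎ l ≡ neg (x j)
  C-shape = prime-pair C∈φ ¬xi∈C ¬xj∈C (pair-implicate i j i≢j)

  -- The other clause A of Q_{φ,i}. (Abstract, like A-fires and r-auxiliary below: only the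
  -- stated properties are used, and unfolding the proofs would make type checking slow.)
  abstract
    partner-of-C : ∃[ A ] (A ∈ Q φ i × ¬ (C ≈C A) × (∀ {D} → D ∈ Q φ i → D ≡ C ⊎ D ≡ A))
    partner-of-C = partner (λ (C⊆D , D⊆C) → D⊆C , C⊆D) (Q φ i) |Qi|≡2
                     (AllPairs.filter⁺ (λ D → neg (x i) ∈? D) (proj₂ wf)) C∈Qi

  A : Clause n m
  A = proj₁ partner-of-C

  A∈φ : A ∈ φ
  A∈φ = proj₁ (Q⁻ {φ = φ} (proj₁ (proj₂ partner-of-C)))

  ¬xi∈A : neg (x i) ∈ A
  ¬xi∈A = proj₂ (Q⁻ {φ = φ} (proj₁ (proj₂ partner-of-C)))

  C≉A : ¬ (C ≈C A)
  C≉A = proj₁ (proj₂ (proj₂ partner-of-C))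

  Q-cases : ∀ {D} → D ∈ φ → neg (x i) ∈ D → D ≡ C ⊎ D ≡ A
  Q-cases D∈φ ¬xi∈D = proj₂ (proj₂ (proj₂ partner-of-C)) (Q⁺ D∈φ ¬xi∈D)

  without-¬xi? = λ (D : Clause n m) → ¬? (neg (x i) ∈? D)

  φ₀ : CNF n m
  φ₀ = filter without-¬xi? φ

  φ₀-sat : ∀ (β : Assignment) → Sat β φ → Sat β φ₀
  φ₀-sat β β⊨φ = tabulate λ D∈φ₀ → lookup β⊨φ (proj₁ (∈-filter⁻ without-¬xi? {xs = φ} D∈φ₀))

  FiresTowards : Lit n m → Set
  FiresTowards r = r ∈ A × r ≢ neg (x i) ×
                   (∀ {l} → l ∈ A → l ≢ r → l ≢ neg (x i) → Forces φ₀ (neg (x j)) (compl l))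

  EarlyConsequence : Lit n m → Set
  EarlyConsequence h = h ≡ pos (x i) ⊎ Forces φ₀ (neg (x j)) h

  -- ¬x_i is never propagated from x_i, since φ ∧ x_i is satisfiable.
  not-¬xi : ∀ {h} → Forces φ (pos (x i)) h → h ≢ neg (x i)
  not-¬xi forced refl = litVal-compl-true (model i) (pos (x i)) (model-true i)
                          (forces-sound (model i) (model-sat i) (model-true i) forced)

  -- Unit propagation from x_i in φ: the only clauses containing ¬x_i are C, which yields ¬x_j,
  -- and A; so every propagated literal is an early consequence unless A fires.
  propagation-from-xi : ∀ {h} → Forces φ (pos (x i)) h → EarlyConsequence h ⊎ ∃ FiresTowards
  propagation-from-xi start = inj₁ (inj₁ refl)
  propagation-from-xi {h} forced@(fire {D} D∈φ h∈D refuted)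
    with all-or-witness _≟L_ D (λ l∈D l≢h → propagation-from-xi (refuted l∈D l≢h))
  ... | inj₂ fires = inj₂ fires
  ... | inj₁ early with neg (x i) ∈? D
  ...   | no ¬xi∉D = inj₁ (inj₂ (fire (∈-filter⁺ without-¬xi? D∈φ ¬xi∉D) h∈D in-φ₀))
    where
    in-φ₀ : ∀ {l} → l ∈ D → l ≢ h → Forces φ₀ (neg (x j)) (compl l)
    in-φ₀ {l} l∈D l≢h with early l∈D l≢h
    ... | inj₁ cl≡xi = ⊥-elim (¬xi∉D (subst (_∈ D) (compl-flip cl≡xi) l∈D))
    ... | inj₂ from-¬xj = from-¬xj
  ...   | yes ¬xi∈D with Q-cases D∈φ ¬xi∈D
  ...     | inj₁ refl with C-shape h∈D
  ...       | inj₁ refl = ⊥-elim (not-¬xi forced refl)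
  ...       | inj₂ refl = inj₁ (inj₂ start)
  propagation-from-xi {h} forced@(fire D∈φ h∈D refuted) | inj₁ early | yes _ | inj₂ refl =
    inj₂ (h , h∈D , not-¬xi forced , refuted-in-φ₀)
    where
    refuted-in-φ₀ : ∀ {l} → l ∈ A → l ≢ h → l ≢ neg (x i) → Forces φ₀ (neg (x j)) (compl l)
    refuted-in-φ₀ {l} l∈A l≢h l≢¬xi with early l∈A l≢h
    ... | inj₁ cl≡xi = ⊥-elim (l≢¬xi (compl-flip cl≡xi))
    ... | inj₂ from-¬xj = from-¬xj

  -- A must fire: x_i propagates ¬x_l for some l ∉ {i, j}, which is no early consequence
  -- because φ₀ ∧ ¬x_j is satisfied by a model of x_l.
  abstract
    A-fires : ∃ FiresTowards
    A-fires with third (≤-trans (n≤1+n 3) 4≤n) i j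
    ... | l , l≢i , l≢j with propagation-from-xi (forces-¬x i l (≢-sym l≢i))
    ...   | inj₁ (inj₁ ())
    ...   | inj₁ (inj₂ from-¬xj) =
            ⊥-elim (litVal-compl-true (model l) (pos (x l)) (model-true l)
                      (forces-sound (model l) (φ₀-sat (model l) (model-sat l))
                         (cong not (model-false l j l≢j)) from-¬xj))
    ...   | inj₂ fires = fires

  r : Lit n m
  r = proj₁ A-fires

  r∈A : r ∈ A
  r∈A = proj₁ (proj₂ A-fires)

  r≢¬xi : r ≢ neg (x i)
  r≢¬xi = proj₁ (proj₂ (proj₂ A-fires))

  refuted-by-¬xj : ∀ {l} → l ∈ A → l ≢ r → l ≢ neg (x i) → Forces φ₀ (neg (x j)) (compl l)
  refuted-by-¬xj = proj₂ (proj₂ (proj₂ A-fires))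

  -- ¬x_i ∨ r is an implicate: x_i makes ¬x_j true, which refutes the rest of A.
  ¬xi∨r-implicate : Implicate φ (neg (x i) ∷ r ∷ [])
  ¬xi∨r-implicate β β⊨φ with β (x i) in xi
  ... | false = here (cong not xi)
  ... | true with find (lookup β⊨φ A∈φ)
  ...   | l , l∈A , l-true with l ≟L r | l ≟L neg (x i)
  ...     | yes refl | _ = there (here l-true)
  ...     | no _ | yes refl = ⊥-elim (litVal-compl-true β (pos (x i)) xi l-true)
  ...     | no l≢r | no l≢¬xi =
            ⊥-elim (litVal-compl-true β l l-true
                      (forces-sound β (φ₀-sat β β⊨φ) (cong not (at-most-one β β⊨φ i j i≢j xi))
                         (refuted-by-¬xj l∈A l≢r l≢¬xi)))

  A-shape : ∀ {l} → l ∈ A → l ≡ neg (x i) ⊎ l ≡ r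
  A-shape = prime-pair A∈φ ¬xi∈A r∈A ¬xi∨r-implicate

  xi⇒r : ∀ (β : Assignment) → Sat β φ → β (x i) ≡ true → litVal β r ≡ true
  xi⇒r β β⊨φ xi-true with ¬xi∨r-implicate β β⊨φ
  ... | here ¬xi-true = ⊥-elim (litVal-compl-true β (pos (x i)) xi-true ¬xi-true)
  ... | there (here r-true) = r-true

  -- r ≢ ¬x_c for c ∉ {i, j}: otherwise setting x_i to true in a model of x_l (l ∉ {i, j, c})
  -- would keep φ satisfied, as C and A are then satisfied by ¬x_j and ¬x_c; but x_i and x_l
  -- cannot both be true.
  r≢¬x : ∀ c → c ≢ i → c ≢ j → r ≢ neg (x c)
  r≢¬x c c≢i c≢j r≡¬xc with fourth 4≤n i j c
  ... | l , l≢i , l≢j , l≢c =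
    false≢true (trans (sym (at-most-one β β⊨φ i l (≢-sym l≢i) (↦true-here α (x i)))) xl-true)
    where
    α = model l
    β = α [ x i ↦true]

    xl-true : β (x l) ≡ true
    xl-true = trans (↦true-elsewhere α (λ xl≡xi → l≢i (x-injective xl≡xi))) (model-true l)

    ¬x-true : ∀ d → d ≢ i → d ≢ l → litVal β (neg (x d)) ≡ true
    ¬x-true d d≢i d≢l = cong not (trans (↦true-elsewhere α (λ xd≡xi → d≢i (x-injective xd≡xi)))
                                         (model-false l d (≢-sym d≢l)))

    satisfied : ∀ {D} → D ∈ φ → SatClause β D
    satisfied D∈φ with find (lookup (model-sat l) D∈φ)
    ... | (t , v) , tv∈D , tv-true with v ≟V x i
    ...   | no v≢xi = lose tv∈D (trans (litVal-cong t v v (↦true-elsewhere α v≢xi)) tv-true)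
    ...   | yes refl with t
    ...     | true = lose tv∈D (↦true-here α (x i))
    ...     | false with Q-cases D∈φ tv∈D
    ...       | inj₁ refl = lose ¬xj∈C (¬x-true j j≢i (≢-sym l≢j))
    ...       | inj₂ refl = lose (subst (_∈ A) r≡¬xc r∈A) (¬x-true c c≢i (≢-sym l≢c))

    β⊨φ : Sat β φ
    β⊨φ = tabulate satisfied

  r-not-input : ∀ t c → r ≢ (t , x c)
  r-not-input true c r≡xc with c FinP.≟ i
  ... | yes refl = proj₂ (lookup (proj₁ wf) A∈φ) (x i , subst (_∈ A) r≡xc r∈A , ¬xi∈A)
  ... | no c≢i = false≢true (trans (sym (model-false i c (≢-sym c≢i)))
                                   (subst (λ k → litVal (model i) k ≡ true) r≡xc
                                      (xi⇒r (model i) (model-sat i) (model-true i))))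
  r-not-input false c r≡¬xc with c FinP.≟ i | c FinP.≟ j
  ... | yes refl | _ = r≢¬xi r≡¬xc
  ... | no c≢i | no c≢j = r≢¬x c c≢i c≢j r≡¬xc
  ... | no _ | yes refl = C≉A (C⊆A , A⊆C)
    where
    C⊆A : C ⊆C A
    C⊆A l∈C with C-shape l∈C
    ... | inj₁ refl = ¬xi∈A
    ... | inj₂ refl = subst (_∈ A) r≡¬xc r∈A
    A⊆C : A ⊆C C
    A⊆C l∈A with A-shape l∈A
    ... | inj₁ refl = ¬xi∈C
    ... | inj₂ refl = subst (_∈ C) (sym r≡¬xc) ¬xj∈C

  abstract
    r-auxiliary : ∃[ s ] ∃[ y ] (r ≡ (s , inj₂ y))
    r-auxiliary with r in r≡
    ... | (s , inj₂ y) = s , y , refl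
    ... | (t , inj₁ c) = ⊥-elim (r-not-input t c r≡)

sameSign : Bool → Bool → Bool
sameSign true s = s
sameSign false s = not s

sameSign-not : ∀ t s → sameSign (not t) s ≡ not (sameSign t s)
sameSign-not true s = refl
sameSign-not false s = sym (not-involutive s)

sameSign-self : ∀ s → sameSign s s ≡ true
sameSign-self true = refl
sameSign-self false = refl

sameSign-value : ∀ {n m n′ m′} {α : Assignment {n} {m}} {β : Assignment {n′} {m′}} t s v w →
                 β w ≡ litVal α (s , v) → litVal β (sameSign t s , w) ≡ litVal α (t , v)
sameSign-value true true v w βw = βw
sameSign-value true false v w βw = trans (cong not βw) (not-involutive _)
sameSign-value false true v w βw = cong not βw
sameSign-value false false v w βw = βw

-- With A = ¬x_i ∨ r and r = (s , y): drop the clauses containing ¬x_i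
-- or ¬x_j, delete x_j from the remaining ones, and merge x_i and r into one input variable,
-- renaming y to that variable (with the sign of r) and re-indexing the inputs without x_j.
module Reduction {n₁ m : ℕ} (φ : CNF (suc n₁) m) (wf : WFCNF φ) (pr : Prime φ) (pe : PEncoding φ)
                 (4≤n : 4 ≤ suc n₁) (|Q|≡2 : ∀ i → size (Q φ i) ≡ 2) (i j : Fin (suc n₁)) (j≢i : j ≢ i)
                 (C : Clause (suc n₁) m) (C∈Qi : C ∈ Q φ i) (b : Bool) (bxj∈C : (b , x j) ∈ C) where
  open Literals {suc n₁} {m}
  open UnitPropagation {suc n₁} {m}
  open Normalisation {n₁} {m}
  open PEncodingFacts φ pe
  open QStructure φ wf pr pe 4≤n i j j≢i (|Q|≡2 i) C C∈Qi b bxj∈C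
  open DecMembership {A = Lit (suc n₁) m} _≟L_ using (_∈?_)
  module Reduced = UnitPropagation {n₁} {m}

  s : Bool
  s = proj₁ r-auxiliary

  y : Fin m
  y = proj₁ (proj₂ r-auxiliary)

  r≡sy : r ≡ (s , inj₂ y)
  r≡sy = proj₂ (proj₂ r-auxiliary)

  -- The new index of x_i, which becomes the merged variable.
  slot : Fin n₁
  slot = punchOut j≢i

  -- Re-indexing of the inputs without x_j (x_j itself, which disappears, is sent to slot).
  squeeze : Fin (suc n₁) → Fin n₁
  squeeze c with j FinP.≟ c
  ... | yes _ = slot
  ... | no j≢c = punchOut j≢c

  squeeze-i : squeeze i ≡ slot
  squeeze-i with j FinP.≟ i
  ... | yes _ = refl
  ... | no _ = punchOut-cong j refl

  squeeze-punchIn : ∀ p → squeeze (punchIn j p) ≡ p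
  squeeze-punchIn p with j FinP.≟ punchIn j p
  ... | yes j≡ = ⊥-elim (punchInᵢ≢i j p (sym j≡))
  ... | no _ = trans (punchOut-cong j refl) (punchOut-punchIn j)

  punchIn-squeeze : ∀ c → c ≢ j → punchIn j (squeeze c) ≡ c
  punchIn-squeeze c c≢j with j FinP.≟ c
  ... | yes j≡c = ⊥-elim (c≢j (sym j≡c))
  ... | no j≢c = punchIn-punchOut j≢c

  rename : Lit (suc n₁) m → Lit n₁ m
  rename (t , inj₁ c) = t , inj₁ (squeeze c)
  rename (t , inj₂ w) with w FinP.≟ y
  ... | yes _ = sameSign t s , inj₁ slot
  ... | no _ = t , inj₂ w

  rename-compl : ∀ l → rename (compl l) ≡ compl (rename l)
  rename-compl (t , inj₁ c) = refl
  rename-compl (t , inj₂ w) with w FinP.≟ y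
  ... | yes _ = cong (_, inj₁ slot) (sameSign-not t s)
  ... | no _ = refl

  rename-r : rename r ≡ pos (x slot)
  rename-r rewrite r≡sy with y FinP.≟ y
  ... | yes _ = cong (_, inj₁ slot) (sameSign-self s)
  ... | no y≢y = ⊥-elim (y≢y refl)

  rename-xi : ∀ t → rename (t , x i) ≡ (t , x slot)
  rename-xi t = cong (λ c → t , inj₁ c) squeeze-i

  rename-x : ∀ t p → rename (t , x (punchIn j p)) ≡ (t , x p)
  rename-x t p = cong (λ c → t , inj₁ c) (squeeze-punchIn p)

  ¬xi∈? : (D : Clause (suc n₁) m) → Dec (neg (x i) ∈ D)
  ¬xi∈? D = neg (x i) ∈? D

  ¬xj∈? : (D : Clause (suc n₁) m) → Dec (neg (x j) ∈ D)
  ¬xj∈? D = neg (x j) ∈? D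

  survives? : Decidable (λ D → neg (x i) ∉ D × neg (x j) ∉ D)
  survives? = neither? ¬xi∈? ¬xj∈?

  shrink : Clause (suc n₁) m → Clause n₁ m
  shrink D = map rename (remove (pos (x j)) D)

  ψ : CNF n₁ m
  ψ = map shrink (filter survives? φ)

  φ′ : CNF n₁ m
  φ′ = normalise ψ

  shrink∈ψ : ∀ {D} → D ∈ φ → neg (x i) ∉ D → neg (x j) ∉ D → shrink D ∈ ψ
  shrink∈ψ D∈φ ¬xi∉D ¬xj∉D = ∈-map⁺ shrink (∈-filter⁺ survives? D∈φ (¬xi∉D , ¬xj∉D))

  module PropagationTransfer (α : Assignment) (α⊨φ : Sat α φ) (xj-false : α (x j) ≡ false)
                             (g : Lit (suc n₁) m) (g-true : litVal α g ≡ true) where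

    not-xj : ∀ {h} → Forces φ g h → h ≢ pos (x j)
    not-xj forced refl = false≢true (trans (sym xj-false) (forces-sound α α⊨φ g-true forced))

    transfer : ∀ {h} → Forces φ g h → h ≡ neg (x j) ⊎ Reduced.Forces ψ (rename g) (rename h)
    transfer start = inj₂ Reduced.start
    transfer {h} forced@(fire {D} D∈φ h∈D refuted) with neg (x j) ∈? D | neg (x i) ∈? D
    ... | yes ¬xj∈D | _ with h ≟L neg (x j)
    ...   | yes h≡¬xj = inj₁ h≡¬xj
    ...   | no h≢¬xj = ⊥-elim (not-xj (refuted ¬xj∈D (≢-sym h≢¬xj)) refl)
    transfer {h} forced@(fire {D} D∈φ h∈D refuted) | no ¬xj∉D | yes ¬xi∈D with Q-cases D∈φ ¬xi∈D
    ... | inj₁ refl = ⊥-elim (¬xj∉D ¬xj∈C)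
    ... | inj₂ refl with A-shape h∈D
    ...   | inj₁ refl with transfer (refuted r∈A r≢¬xi)
    ...     | inj₁ cr≡¬xj = ⊥-elim (r-not-input true j (compl-flip cr≡¬xj))
    ...     | inj₂ cr-forced = inj₂ (subst (Reduced.Forces ψ (rename g)) rename-compl-r cr-forced)
      where
      rename-compl-r : rename (compl r) ≡ rename (neg (x i))
      rename-compl-r = trans (rename-compl r) (trans (cong compl rename-r) (sym (rename-xi false)))
    transfer {h} forced@(fire {D} D∈φ h∈D refuted) | no ¬xj∉D | yes ¬xi∈D | inj₂ refl | inj₂ refl
      with transfer (refuted ¬xi∈A (≢-sym r≢¬xi))
    ... | inj₁ ()
    ... | inj₂ xi-forced =
          inj₂ (subst (Reduced.Forces ψ (rename g)) (trans (rename-xi true) (sym rename-r)) xi-forced)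
    transfer {h} forced@(fire {D} D∈φ h∈D refuted) | no ¬xj∉D | no ¬xi∉D =
      inj₂ (Reduced.fire (shrink∈ψ D∈φ ¬xi∉D ¬xj∉D)
                         (∈-map⁺ rename (∈-filter⁺ drop-xj? h∈D (not-xj forced))) refuted′)
      where
      drop-xj? = λ l → ¬? (l ≟L pos (x j))
      refuted′ : ∀ {l′} → l′ ∈ shrink D → l′ ≢ rename h → Reduced.Forces ψ (rename g) (compl l′)
      refuted′ l′∈ l′≢ with ∈-map⁻ rename l′∈
      ... | l , l∈ , refl with ∈-filter⁻ drop-xj? {xs = D} l∈
      ...   | l∈D , l≢xj with transfer (refuted l∈D (λ l≡h → l′≢ (cong rename l≡h)))
      ...     | inj₁ cl≡¬xj = ⊥-elim (l≢xj (compl-flip cl≡¬xj))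
      ...     | inj₂ cl-forced = subst (Reduced.Forces ψ (rename g)) (rename-compl l) cl-forced

  -- A model α of φ with x_j false yields a model of ψ: the merged variable takes the value of r.
  lift : Assignment {suc n₁} {m} → Assignment {n₁} {m}
  lift α (inj₁ p) with p FinP.≟ slot
  ... | yes _ = litVal α r
  ... | no _ = α (x (punchIn j p))
  lift α (inj₂ w) = α (inj₂ w)

  lift-slot : ∀ α → lift α (x slot) ≡ litVal α r
  lift-slot α with slot FinP.≟ slot
  ... | yes _ = refl
  ... | no slot≢slot = ⊥-elim (slot≢slot refl)

  lift-input : ∀ α c → c ≢ i → c ≢ j → lift α (x (squeeze c)) ≡ α (x c)
  lift-input α c c≢i c≢j with squeeze c FinP.≟ slot
  ... | yes sc≡slot = ⊥-elim (c≢i (begin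
          c                     ≡⟨ punchIn-squeeze c c≢j ⟨
          punchIn j (squeeze c) ≡⟨ cong (punchIn j) sc≡slot ⟩
          punchIn j slot        ≡⟨ punchIn-punchOut j≢i ⟩
          i                     ∎))
    where open ≡-Reasoning
  ... | no _ = cong (λ d → α (x d)) (punchIn-squeeze c c≢j)

  module ModelTransfer (α : Assignment) (α⊨φ : Sat α φ) (xj-false : α (x j) ≡ false) where

    rename-true : ∀ l → litVal α l ≡ true → l ≢ neg (x i) → l ≢ neg (x j) →
                  litVal (lift α) (rename l) ≡ true
    rename-true (t , inj₁ c) l-true l≢¬xi l≢¬xj with c FinP.≟ i | c FinP.≟ j | t
    ... | no c≢i | no c≢j | t =
          trans (litVal-cong t (x c) (x (squeeze c)) (lift-input α c c≢i c≢j)) l-true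
    ... | yes refl | _ | true = trans (cong (lift α) (cong inj₁ squeeze-i))
                                      (trans (lift-slot α) (xi⇒r α α⊨φ l-true))
    ... | yes refl | _ | false = ⊥-elim (l≢¬xi refl)
    ... | no _ | yes refl | true = ⊥-elim (false≢true (trans (sym xj-false) l-true))
    ... | no _ | yes refl | false = ⊥-elim (l≢¬xj refl)
    rename-true (t , inj₂ w) l-true _ _ with w FinP.≟ y
    ... | yes refl =
          trans (sameSign-value t s (inj₂ y) (x slot) (trans (lift-slot α) (cong (litVal α) r≡sy))) l-true
    ... | no _ = trans (litVal-cong t (inj₂ w) (inj₂ w) refl) l-true

    lift-sat : Sat (lift α) ψ
    lift-sat = tabulate satisfied
      where
      satisfied : ∀ {E} → E ∈ ψ → SatClause (lift α) E
      satisfied E∈ψ with ∈-map⁻ shrink E∈ψ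
      ... | D , D∈ , refl with ∈-filter⁻ survives? {xs = φ} D∈
      ...   | D∈φ , (¬xi∉D , ¬xj∉D) with find (lookup α⊨φ D∈φ)
      ...     | l , l∈D , l-true =
                lose (∈-map⁺ rename (∈-filter⁺ (λ k → ¬? (k ≟L pos (x j))) l∈D l≢xj))
                     (rename-true l l-true (λ { refl → ¬xi∉D l∈D }) (λ { refl → ¬xj∉D l∈D }))
        where
        l≢xj : l ≢ pos (x j)
        l≢xj refl = false≢true (trans (sym xj-false) l-true)

  module InputModel (p : Fin n₁) where
    c : Fin (suc n₁)
    c = punchIn j p

    α : Assignment
    α = model c

    xj-false : α (x j) ≡ false
    xj-false = model-false c j (punchInᵢ≢i j p)

    open ModelTransfer α (model-sat c) xj-false public

    xp-true : lift α (x p) ≡ true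
    xp-true with p FinP.≟ slot
    ... | no _ = model-true c
    ... | yes refl =
          xi⇒r α (model-sat c) (subst (λ d → α (x d) ≡ true) (punchIn-punchOut j≢i) (model-true c))

  reduced-P1 : ∀ p → ∃[ β ] (β (x p) ≡ true × Sat β φ′)
  reduced-P1 p = lift α , xp-true , normalise-sat (lift α) lift-sat
    where open InputModel p

  reduced-P2 : ∀ p q → p ≢ q → φ′ ∧ pos (x p) ⊢₁ neg (x q)
  reduced-P2 p q p≢q =
    Reduced.forces⇒⊢₁ (normalise-unique ψ) (normalise-forces (lift α) lift-sat xp-true forced-in-ψ)
    where
    open InputModel p
    d = punchIn j q
    forced-in-ψ : Reduced.Forces ψ (pos (x p)) (neg (x q))
    forced-in-ψ with PropagationTransfer.transfer α (model-sat c) xj-false (pos (x c)) (model-true c)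
                       (forces-¬x c d (λ c≡d → p≢q (punchIn-injective j p q c≡d)))
    ... | inj₁ ¬xd≡¬xj = ⊥-elim (punchInᵢ≢i j q (x-injective (cong proj₂ ¬xd≡¬xj)))
    ... | inj₂ forced = subst₂ (Reduced.Forces ψ) (rename-x true p) (rename-x false q) forced

  -- Only C contains both ¬x_i and ¬x_j, since A = ¬x_i ∨ r with r auxiliary.
  common-is-C : ∀ {D} → D ∈ filter (both? ¬xi∈? ¬xj∈?) φ → D ≡ C
  common-is-C D∈ with ∈-filter⁻ (both? ¬xi∈? ¬xj∈?) {xs = φ} D∈
  ... | D∈φ , (¬xi∈D , ¬xj∈D) with Q-cases D∈φ ¬xi∈D
  ...   | inj₁ D≡C = D≡C
  ...   | inj₂ refl with A-shape ¬xj∈D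
  ...     | inj₁ ¬xj≡¬xi = ⊥-elim (j≢i (x-injective (cong proj₂ ¬xj≡¬xi)))
  ...     | inj₂ ¬xj≡r = ⊥-elim (r-not-input false j (sym ¬xj≡r))

  -- Four occurrences of ¬x_i or ¬x_j lie in at least three distinct clauses, all dropped.
  ψ-size : size ψ + 3 ≤ size φ
  ψ-size = begin
    size ψ + 3                      ≡⟨ cong (_+ 3) (length-map shrink (filter survives? φ)) ⟩
    length (filter survives? φ) + 3 ≤⟨ three-dropped _ _ _ counted common≤1 ⟩
    size φ                          ∎
    where
    open ≤-Reasoning
    counted : length (filter survives? φ) + 2 + 2 ≡ length φ + length (filter (both? ¬xi∈? ¬xj∈?) φ)
    counted = trans (cong₂ (λ a b → length (filter survives? φ) + a + b) (sym (|Q|≡2 i)) (sym (|Q|≡2 j)))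
                    (filter-count ¬xi∈? ¬xj∈? φ)
    ≈C-refl : ∀ {D : Clause (suc n₁) m} → D ≈C D
    ≈C-refl = (λ l∈ → l∈) , (λ l∈ → l∈)
    common≤1 : length (filter (both? ¬xi∈? ¬xj∈?) φ) ≤ 1
    common≤1 = at-most-one-copy ≈C-refl _ (AllPairs.filter⁺ _ (proj₂ wf)) common-is-C

  ψ-2cnf : Is2CNF φ → Is2CNF ψ
  ψ-2cnf φ-2cnf = tabulate short
    where
    short : ∀ {E} → E ∈ ψ → length E ≤ 2
    short E∈ψ with ∈-map⁻ shrink E∈ψ
    ... | D , D∈ , refl = begin
      length (map rename (remove (pos (x j)) D)) ≡⟨ length-map rename (remove (pos (x j)) D) ⟩
      length (remove (pos (x j)) D)              ≤⟨ length-filter (λ l → ¬? (l ≟L pos (x j))) D ⟩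
      length D                                   ≤⟨ lookup φ-2cnf (proj₁ (∈-filter⁻ survives? {xs = φ} D∈)) ⟩
      2                                          ∎
      where open ≤-Reasoning

  reduced-wf : WFCNF φ′
  reduced-wf = normalise-wf ψ

  reduced-pencoding : PEncoding φ′
  reduced-pencoding = reduced-P1 , reduced-P2

  reduced-size : size φ′ + 3 ≤ size φ
  reduced-size = ≤-trans (+-monoˡ-≤ 3 (normalise-size ψ)) ψ-size

  reduced-2cnf : Is2CNF φ → Is2CNF φ′
  reduced-2cnf φ-2cnf = normalise-2cnf ψ (ψ-2cnf φ-2cnf)

proposition4 : ∀ (n m : ℕ) (φ : CNF n m) →
    4 ≤ n →
    WFCNF φ →
    Prime φ →
    PEncoding φ →
    (∀ (i : Fin n) → size (Q φ i) ≡ 2) →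
    (∃[ i ] ∃[ C ] ((C ∈ Q φ i) × (∃[ j ] ∃[ b ] ((j ≢ i) × ((b , x j) ∈ C))))) →
    ∃[ m′ ] ∃[ φ′ ] (WFCNF {pred n} {m′} φ′ × PEncoding φ′ × (size φ′ + 3 ≤ size φ)
    × (Is2CNF φ → Is2CNF φ′))
proposition4 (suc n₁) m φ 4≤n wf pr pe |Q|≡2 (i , C , C∈Qi , j , b , j≢i , bxj∈C) =
  m , φ′ , reduced-wf , reduced-pencoding , reduced-size , reduced-2cnf
  where open Reduction φ wf pr pe 4≤n |Q|≡2 i j j≢i C C∈Qi b bxj∈C
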